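{- Let $D\ge2$, $N\in\{2D,2D+1\}$, and let $\Gamma$, $V$, $\Lambda$, $\mathcal O(\Gamma)$ and $\chi_\Omega$ be as in the context. Then $\chi_\Omega\in\Lambda$ for every $\Omega\in\mathcal O(\Gamma)$.
   Context: $\Gamma$ is the cycle graph on $X=\{0,\dots,N-1\}=\mathbb{Z}/N\mathbb{Z}$, with $x\sim y$ iff $x-y\equiv\pm1 \pmod N$. Its distance is $\partial(x,y)=\min\{r,N-r\}$ with $r\equiv x-y \pmod N$, $0\le r<N$, and its diameter is $D$. Fix a primitive $N$-th root of unity $\zeta$ and set $\theta^*_i=\zeta^i+\zeta^{ -i}$. $V$ has orthonormal basis $X$ and $A_1x=(x-1)+(x+1)$. On $V^{\otimes3}$ let $A^{(1)}=A_1\otimes I\otimes I$, $A^{(2)}=I\otimes A_1\otimes I$ and $A^{(3)}=I\otimes I\otimes A_1$. Let $A^{*(1)},A^{*(2)},A^{*(3)}$ multiply $x\otimes y\otimes z$ by $\theta^*_{\partial(y,z)}$, $\theta^*_{\partial(x,z)}$ and $\theta^*_{\partial(x,y)}$ respectively. $\Lambda$ (the fundamental module) is the smallest subspace of $V^{\otimes3}$ containing $\mathbf 1^{\otimes3}=\sum_{x,y,z}x\otimes y\otimes z$ and invariant under these six maps. It is the unique irreducible submodule containing $\mathbf 1^{\otimes3}$ for the associated $S_3$-symmetric tridiagonal algebra. $\mathcal O(\Gamma)$ is the set of orbits of $\operatorname{Aut}(\Gamma)$ (dihedral of order $2N$) acting diagonally on $X^3$, and $\chi_\Omega=\sum_{(x,y,z)\in\Omega}x\otimes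 y\otimes z$. -}

module Defs where

open import Level using (Level; _⊔_)
open import Algebra.Bundles using (CommutativeRing; Semiring)
open import Data.Nat using (ℕ; zero; suc; _∸_; _⊓_; _<_; NonZero)
import Data.Nat as ℕ
open import Data.Nat.DivMod using (_%_; m%n<n)
open import Data.Fin using (Fin; toℕ; fromℕ<)
open import Data.Fin.Permutation using (Permutation′; _⟨$⟩ʳ_)
open import Data.Product using (Σ; ∃; _×_; _,_)
open import Data.Sum using (_⊎_)
open import Function.Bundles using (_⇔_)
open import Relation.Nullary using (¬_)
open import Relation.Binary.PropositionalEquality using (_≡_)

module _ (N : ℕ) {{_ : NonZero N}} where

  vert : ℕ → Fin N
  vert m = fromℕ< (m%n<n m N)

  sucV : Fin N → Fin N
  sucV x = vert (toℕ x ℕ.+ 1)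

  predV : Fin N → Fin N
  predV x = vert (toℕ x ℕ.+ (N ∸ 1))

  res : Fin N → Fin N → ℕ
  res x y = (toℕ x ℕ.+ (N ∸ toℕ y)) % N

  dist : Fin N → Fin N → ℕ
  dist x y = res x y ⊓ (N ∸ res x y)

  Adj : Fin N → Fin N → Set
  Adj x y = res x y ≡ 1 ⊎ res x y ≡ N ∸ 1

  record Aut : Set where
    field
      perm      : Permutation′ N
      preserves : ∀ x y → Adj x y ⇔ Adj (perm ⟨$⟩ʳ x) (perm ⟨$⟩ʳ y)

  SameOrbit : Fin N × Fin N × Fin N → Fin N × Fin N × Fin N → Set
  SameOrbit (x , y , z) (x' , y' , z') =
    Σ Aut λ g → let σ = Aut.perm g in
      (σ ⟨$⟩ʳ x ≡ x') × (σ ⟨$⟩ʳ y ≡ y') × (σ ⟨$⟩ʳ z ≡ z')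

module _ {c ℓ : Level} (F : CommutativeRing c ℓ) where
  open CommutativeRing F using (Carrier; _≈_; _+_; _*_; 0#; 1#; semiring)
  open import Algebra.Definitions.RawSemiring (Semiring.rawSemiring semiring) using (_^_) renaming (_×_ to _·ℕ_)

  record IsField : Set (c ⊔ ℓ) where
    field
      1≉0 : ¬ (1# ≈ 0#)
      inv : ∀ x → ¬ (x ≈ 0#) → ∃ λ y → x * y ≈ 1#

  CharZero : Set ℓ
  CharZero = ∀ n → n ·ℕ 1# ≈ 0# → n ≡ 0

  IsPrimitiveRoot : ℕ → Carrier → Set ℓ
  IsPrimitiveRoot N ζ = (ζ ^ N ≈ 1#) × (∀ k → 0 < k → k < N → ¬ (ζ ^ k ≈ 1#))

  -- vectors of V⊗V⊗V, given by their coefficients on the basis x⊗y⊗z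
  Tensor3 : ℕ → Set c
  Tensor3 N = Fin N → Fin N → Fin N → Carrier

  module _ (N : ℕ) {{_ : NonZero N}} (ζ : Carrier) where

    -- θ*_i = ζ^i + ζ^{-i}; here ζ^{-i} is written ζ^{N-i} (valid since ζ^N = 1, i ≤ N)
    θ* : ℕ → Carrier
    θ* i = ζ ^ i + ζ ^ (N ∸ i)

    A⁽¹⁾ A⁽²⁾ A⁽³⁾ : Tensor3 N → Tensor3 N
    A⁽¹⁾ v x y z = v (predV N x) y z + v (sucV N x) y z
    A⁽²⁾ v x y z = v x (predV N y) z + v x (sucV N y) z
    A⁽³⁾ v x y z = v x y (predV N z) + v x y (sucV N z)

    A*⁽¹⁾ A*⁽²⁾ A*⁽³⁾ : Tensor3 N → Tensor3 N
    A*⁽¹⁾ v x y z = θ* (dist N y z) * v x y z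
    A*⁽²⁾ v x y z = θ* (dist N x z) * v x y z
    A*⁽³⁾ v x y z = θ* (dist N x y) * v x y z

    ones : Tensor3 N
    ones _ _ _ = 1#

    -- Λ: the smallest subspace containing 1⊗1⊗1 and invariant under the six maps
    -- (inductive closure; membership is up to the setoid equality of F)
    data InΛ : Tensor3 N → Set (c ⊔ ℓ) where
      gen   : InΛ ones
      zero  : InΛ (λ _ _ _ → 0#)
      add   : ∀ {v w} → InΛ v → InΛ w → InΛ (λ x y z → v x y z + w x y z)
      scale : ∀ {v} (a : Carrier) → InΛ v → InΛ (λ x y z → a * v x y z)
      resp  : ∀ {v w} → (∀ x y z → v x y z ≈ w x y z) → InΛ v → InΛ w
      a1    : ∀ {v} → InΛ v → InΛ (A⁽¹⁾ v)
      a2    : ∀ {v} → InΛ v → InΛ (A⁽²⁾ v)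
      a3    : ∀ {v} → InΛ v → InΛ (A⁽³⁾ v)
      a*1   : ∀ {v} → InΛ v → InΛ (A*⁽¹⁾ v)
      a*2   : ∀ {v} → InΛ v → InΛ (A*⁽²⁾ v)
      a*3   : ∀ {v} → InΛ v → InΛ (A*⁽³⁾ v)

-- An automorphism of the N-cycle preserves ∂, and conversely two triples with the same three
-- pairwise distances differ by a rotation or a reflection: equal distances make the residues
-- y − x and z − x agree with their primed counterparts up to sign, and the relation
-- (z − x) = (z − y) + (y − x) forces the two signs to be equal. So the orbit Ω of (x, y, z) is
-- the set where ∂(y,z), ∂(x,z), ∂(x,y) take prescribed values. Since ζ is primitive and
-- 2D ≤ N, the numbers θ*_0, …, θ*_D are pairwise distinct (θ*_m − θ*_k is ζ^m times
-- (1 − ζ^(k−m)) (1 − ζ^(−k−m))), so a Lagrange polynomial in A*⁽ⁱ⁾ projects onto a level set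
-- of the corresponding distance; the three projections applied to 1⊗1⊗1 give χ_Ω.

module Submission where

open import Defs
open import Level using (0ℓ)
open import Algebra.Bundles using (CommutativeRing; Semiring)
open import Data.Nat using (ℕ; zero; suc; _∸_; _⊓_; _≤_; _<_; pred; NonZero; z≤n; s≤s; s≤s⁻¹; z<s)
import Data.Nat as ℕ
import Data.Nat.Properties as ℕₚ
open import Data.Nat.DivMod using (_%_; m%n%n≡m%n; n%n≡0; [m+n]%n≡m%n; m<n⇒m%n≡m; m%n≤n; m%n<n; %-distribˡ-+)
open import Data.Fin using (Fin; toℕ)
open import Data.Fin.Properties using (toℕ-injective; toℕ<n; toℕ-fromℕ<)
open import Data.Fin.Permutation using (Permutation′; _⟨$⟩ʳ_; _⟨$⟩ˡ_; inverseˡ; inverseʳ; permutation)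
open import Data.Empty using (⊥-elim)
open import Data.Product using (Σ; _×_; _,_; proj₁; proj₂)
open import Data.Sum using (_⊎_; inj₁; inj₂)
import Data.Sum as Sum
open import Function.Base using (_∘_)
open import Function.Bundles using (Equivalence; _⇔_; mk⇔)
open import Relation.Nullary using (¬_; Dec; yes; no)
open import Relation.Binary.Bundles using (Setoid)
open import Relation.Binary.Definitions using (Tri; tri<; tri≈; tri>)
import Relation.Binary.Construct.On as On
import Relation.Binary.Reasoning.Setoid as SetoidReasoning
open import Relation.Binary.PropositionalEquality as ≡ using (_≡_; _≢_)

module Modular (N : ℕ) {{_ : NonZero N}} where
  open import Data.Nat using (_+_)
  open import Data.Nat.Properties
  open import Algebra.Properties.CommutativeSemigroup +-commutativeSemigroup using (interchange)
  open ≡ using (refl; sym; trans; cong; cong₂; subst₂)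

  infix 4 _≡ₘ_ _≡±_

  _≡ₘ_ : ℕ → ℕ → Set
  a ≡ₘ b = a % N ≡ b % N

  ≡ₘ-setoid : Setoid 0ℓ 0ℓ
  ≡ₘ-setoid = On.setoid (≡.setoid ℕ) (_% N)

  module ≡ₘ-Reasoning = SetoidReasoning ≡ₘ-setoid

  _≡±_ : ℕ → ℕ → Set
  a ≡± b = a ≡ₘ b ⊎ a + b ≡ₘ 0

  %-≡ₘ : ∀ a → a % N ≡ₘ a
  %-≡ₘ a = m%n%n≡m%n a N

  N≡ₘ0 : N ≡ₘ 0
  N≡ₘ0 = [m+n]%n≡m%n 0 N

  +N≡ₘ : ∀ a → a + N ≡ₘ a
  +N≡ₘ a = [m+n]%n≡m%n a N

  ≡ₘ⇒≡ : ∀ {a b} → a < N → b < N → a ≡ₘ b → a ≡ b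
  ≡ₘ⇒≡ a<N b<N a≡b = trans (sym (m<n⇒m%n≡m a<N)) (trans a≡b (m<n⇒m%n≡m b<N))

  +-congₘ : ∀ {a a' b b'} → a ≡ₘ a' → b ≡ₘ b' → a + b ≡ₘ a' + b'
  +-congₘ {a} {a'} {b} {b'} a≡a' b≡b' = begin
    (a + b) % N              ≡⟨ %-distribˡ-+ a b N ⟩
    (a % N + b % N) % N      ≡⟨ cong₂ (λ u v → (u + v) % N) a≡a' b≡b' ⟩
    (a' % N + b' % N) % N    ≡⟨ %-distribˡ-+ a' b' N ⟨
    (a' + b') % N            ∎
    where open ≡.≡-Reasoning

  +-congˡₘ : ∀ a {b b'} → b ≡ₘ b' → a + b ≡ₘ a + b'
  +-congˡₘ a = +-congₘ {a} refl

  +-congʳₘ : ∀ {a a'} b → a ≡ₘ a' → a + b ≡ₘ a' + b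
  +-congʳₘ b a≡a' = +-congₘ a≡a' (refl {x = b % N})

  +-inverseʳₘ : ∀ a → a + (N ∸ a % N) ≡ₘ 0
  +-inverseʳₘ a = begin
    a + (N ∸ a % N)        ≈⟨ +-congʳₘ (N ∸ a % N) (%-≡ₘ a) ⟨
    a % N + (N ∸ a % N)    ≡⟨ m+[n∸m]≡n (m%n≤n a N) ⟩
    N                      ≈⟨ N≡ₘ0 ⟩
    0                      ∎
    where open ≡ₘ-Reasoning

  +-cancelʳₘ : ∀ {a b} c → a + c ≡ₘ b + c → a ≡ₘ b
  +-cancelʳₘ {a} {b} c a+c≡b+c = begin
    a                       ≡⟨ +-identityʳ a ⟨
    a + 0                   ≈⟨ +-congˡₘ a (+-inverseʳₘ c) ⟨
    a + (c + c⁻)            ≡⟨ +-assoc a c c⁻ ⟨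
    a + c + c⁻              ≈⟨ +-congʳₘ c⁻ a+c≡b+c ⟩
    b + c + c⁻              ≡⟨ +-assoc b c c⁻ ⟩
    b + (c + c⁻)            ≈⟨ +-congˡₘ b (+-inverseʳₘ c) ⟩
    b + 0                   ≡⟨ +-identityʳ b ⟩
    b                       ∎
    where
    open ≡ₘ-Reasoning
    c⁻ : ℕ
    c⁻ = N ∸ c % N

  +-cancelˡₘ : ∀ {a b} c → c + a ≡ₘ c + b → a ≡ₘ b
  +-cancelˡₘ {a} {b} c c+a≡c+b = +-cancelʳₘ c (subst₂ _≡ₘ_ (+-comm c a) (+-comm c b) c+a≡c+b)

  signs-agree : ∀ {a b c a' b' c'} → c ≡ₘ a + b → c' ≡ₘ a' + b' →
                a ≡± a' → b ≡± b' → c ≡± c' →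
                (b ≡ₘ b' × c ≡ₘ c') ⊎ (b + b' ≡ₘ 0 × c + c' ≡ₘ 0)
  signs-agree {a} {b} {c} {a'} {b'} {c'} c≡a+b c'≡a'+b' = go
    where
    open ≡ₘ-Reasoning
    sum : c + c' ≡ₘ (a + a') + (b + b')
    sum = trans (+-congₘ c≡a+b c'≡a'+b') (cong (_% N) (interchange a b a' b'))
    go : a ≡± a' → b ≡± b' → c ≡± c' → (b ≡ₘ b' × c ≡ₘ c') ⊎ (b + b' ≡ₘ 0 × c + c' ≡ₘ 0)
    go _            (inj₁ b≡b')  (inj₁ c≡c')  = inj₁ (b≡b' , c≡c')
    go _            (inj₂ b≡-b') (inj₂ c≡-c') = inj₂ (b≡-b' , c≡-c')
    go (inj₁ a≡a')  (inj₁ b≡b')  (inj₂ _)     =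
      inj₁ (b≡b' , trans c≡a+b (trans (+-congₘ a≡a' b≡b') (sym c'≡a'+b')))
    go (inj₂ a≡-a') (inj₁ b≡b')  (inj₂ c≡-c') = inj₂ (+-cancelʳₘ (a + a') (begin
      b + b' + (a + a')   ≡⟨ +-comm (b + b') (a + a') ⟩
      a + a' + (b + b')   ≈⟨ sum ⟨
      c + c'              ≈⟨ c≡-c' ⟩
      0                   ≈⟨ a≡-a' ⟨
      0 + (a + a')        ∎) , c≡-c')
    go (inj₁ a≡a')  (inj₂ b≡-b') (inj₁ c≡c')  = inj₁ (+-cancelˡₘ a (begin
      a + b      ≈⟨ c≡a+b ⟨
      c          ≈⟨ c≡c' ⟩
      c'         ≈⟨ c'≡a'+b' ⟩
      a' + b'    ≈⟨ +-congʳₘ b' a≡a' ⟨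
      a + b'     ∎) , c≡c')
    go (inj₂ a≡-a') (inj₂ b≡-b') (inj₁ _)     = inj₂ (b≡-b' , (begin
      c + c'              ≈⟨ sum ⟩
      a + a' + (b + b')   ≈⟨ +-congₘ a≡-a' b≡-b' ⟩
      0                   ∎))

  -- dist N x y unfolds to fold (res N x y).
  fold : ℕ → ℕ
  fold r = r ⊓ (N ∸ r)

  fold-cases : ∀ r → fold r ≡ r ⊎ fold r ≡ N ∸ r
  fold-cases r = ⊓-sel r (N ∸ r)

  fold[N∸r]≡fold[r] : ∀ {r} → r ≤ N → fold (N ∸ r) ≡ fold r
  fold[N∸r]≡fold[r] {r} r≤N = trans (cong ((N ∸ r) ⊓_) (m∸[m∸n]≡n r≤N)) (⊓-comm (N ∸ r) r)

  fold[r%N]≡fold[r] : ∀ {r} → r ≤ N → fold (r % N) ≡ fold r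
  fold[r%N]≡fold[r] r≤N with m≤n⇒m<n∨m≡n r≤N
  ... | inj₁ r<N = cong fold (m<n⇒m%n≡m r<N)
  ... | inj₂ refl = trans (cong fold (n%n≡0 N)) (sym (fold[N∸r]≡fold[r] {0} z≤n))

  fold-≡ₘ : ∀ {r s} → r ≤ N → s ≤ N → r ≡ₘ s → fold r ≡ fold s
  fold-≡ₘ r≤N s≤N r≡s =
    trans (sym (fold[r%N]≡fold[r] r≤N)) (trans (cong fold r≡s) (fold[r%N]≡fold[r] s≤N))

  ≡N∸⇒+≡ₘ0 : ∀ {a b} → b ≤ N → a ≡ N ∸ b → a + b ≡ₘ 0
  ≡N∸⇒+≡ₘ0 {a} {b} b≤N a≡N∸b = trans (cong (_% N) (trans (cong (_+ b) a≡N∸b) (m∸n+n≡m b≤N))) N≡ₘ0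

  fold-injective : ∀ {r s} → r ≤ N → s ≤ N → fold r ≡ fold s → r ≡± s
  fold-injective {r} {s} r≤N s≤N eq with fold-cases r | fold-cases s
  ... | inj₁ fr≡r   | inj₁ fs≡s   = inj₁ (cong (_% N) (trans (sym fr≡r) (trans eq fs≡s)))
  ... | inj₁ fr≡r   | inj₂ fs≡N∸s = inj₂ (≡N∸⇒+≡ₘ0 s≤N (trans (sym fr≡r) (trans eq fs≡N∸s)))
  ... | inj₂ fr≡N∸r | inj₁ fs≡s   =
    inj₂ (trans (cong (_% N) (+-comm r s)) (≡N∸⇒+≡ₘ0 r≤N (trans (sym fs≡s) (trans (sym eq) fr≡N∸r))))
  ... | inj₂ fr≡N∸r | inj₂ fs≡N∸s =
    inj₁ (cong (_% N) (∸-cancelˡ-≡ r≤N s≤N (trans (sym fr≡N∸r) (trans eq fs≡N∸s))))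

  fold[1+r]≤1+fold[r] : ∀ r → fold (suc r) ≤ suc (fold r)
  fold[1+r]≤1+fold[r] r = ⊓-monoʳ-≤ (suc r) (≤-trans (∸-monoʳ-≤ N (n≤1+n r)) (n≤1+n (N ∸ r)))

  fold[1+n]≡1+n⇒fold[n]≡n : ∀ {n} → fold (suc n) ≡ suc n → fold n ≡ n
  fold[1+n]≡1+n⇒fold[n]≡n {n} eq = m≤n⇒m⊓n≡m (begin
    n              ≤⟨ n≤1+n n ⟩
    suc n          ≡⟨ eq ⟨
    fold (suc n)   ≤⟨ m⊓n≤n (suc n) (N ∸ suc n) ⟩
    N ∸ suc n      ≤⟨ ∸-monoʳ-≤ N (n≤1+n n) ⟩
    N ∸ n          ∎)
    where open ≤-Reasoning

  fold[r]≡N∸r⇒fold[1+r]≡fold[r]∸1 : ∀ {r n} → fold r ≡ N ∸ r → fold r ≡ suc n → fold (suc r) ≡ n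
  fold[r]≡N∸r⇒fold[1+r]≡fold[r]∸1 {r} {n} fr≡N∸r fr≡1+n = trans (m≥n⇒m⊓n≡n N∸[1+r]≤1+r) N∸[1+r]≡n
    where
    N∸[1+r]≡n : N ∸ suc r ≡ n
    N∸[1+r]≡n = trans (sym (pred[m∸n]≡m∸[1+n] N r)) (cong pred (trans (sym fr≡N∸r) fr≡1+n))
    N∸[1+r]≤1+r : N ∸ suc r ≤ suc r
    N∸[1+r]≤1+r = begin
      N ∸ suc r   ≤⟨ ∸-monoʳ-≤ N (n≤1+n r) ⟩
      N ∸ r       ≡⟨ fr≡N∸r ⟨
      fold r      ≤⟨ m⊓n≤m r (N ∸ r) ⟩
      r           ≤⟨ n≤1+n r ⟩
      suc r       ∎
      where open ≤-Reasoning

  fold≤ : ∀ {D} → N ≤ suc (D + D) → ∀ r → fold r ≤ D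
  fold≤ {D} N≤1+2D r with r ≤? D
  ... | yes r≤D = ≤-trans (m⊓n≤m r (N ∸ r)) r≤D
  ... | no r≰D = begin
    fold r              ≤⟨ m⊓n≤n r (N ∸ r) ⟩
    N ∸ r               ≤⟨ ∸-mono N≤1+2D (≰⇒> r≰D) ⟩
    suc (D + D) ∸ suc D ≡⟨ m+n∸m≡n D D ⟩
    D                   ∎
    where open ≤-Reasoning

module Cycle (N : ℕ) {{_ : NonZero N}} (1<N : 1 < N) where
  open import Data.Nat using (_+_)
  open import Data.Nat.Properties
  open import Algebra.Properties.CommutativeSemigroup +-commutativeSemigroup using (x∙yz≈y∙xz)
  open ≡ using (refl; sym; trans; cong; subst; subst₂)
  open Modular N

  0<N : 0 < N
  0<N = <-trans z<s 1<N

  toℕ-vert : ∀ m → toℕ (vert N m) ≡ₘ m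
  toℕ-vert m = trans (cong (_% N) (toℕ-fromℕ< (m%n<n m N))) (%-≡ₘ m)

  toℕ-≡ₘ-injective : ∀ {x y : Fin N} → toℕ x ≡ₘ toℕ y → x ≡ y
  toℕ-≡ₘ-injective {x} {y} eq = toℕ-injective (≡ₘ⇒≡ (toℕ<n x) (toℕ<n y) eq)

  res<N : ∀ x y → res N x y < N
  res<N x y = m%n<n _ N

  res≤N : ∀ x y → res N x y ≤ N
  res≤N x y = <⇒≤ (res<N x y)

  res-+ : ∀ x y → res N x y + toℕ y ≡ₘ toℕ x
  res-+ x y = begin
    res N x y + toℕ y               ≈⟨ +-congʳₘ (toℕ y) (%-≡ₘ _) ⟩
    toℕ x + (N ∸ toℕ y) + toℕ y     ≡⟨ +-assoc (toℕ x) (N ∸ toℕ y) (toℕ y) ⟩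
    toℕ x + (N ∸ toℕ y + toℕ y)     ≡⟨ cong (toℕ x +_) (m∸n+n≡m (<⇒≤ (toℕ<n y))) ⟩
    toℕ x + N                       ≈⟨ +N≡ₘ (toℕ x) ⟩
    toℕ x                           ∎
    where open ≡ₘ-Reasoning

  res-unique : ∀ x y {r} → r < N → r + toℕ y ≡ₘ toℕ x → res N x y ≡ r
  res-unique x y r<N eq = ≡ₘ⇒≡ (res<N x y) r<N (+-cancelʳₘ (toℕ y) (trans (res-+ x y) (sym eq)))

  res-self : ∀ x → res N x x ≡ 0
  res-self x = res-unique x x 0<N refl

  res-trans : ∀ x y z → res N x z ≡ₘ res N x y + res N y z
  res-trans x y z = +-cancelʳₘ (toℕ z) (begin
    res N x z + toℕ z                    ≈⟨ res-+ x z ⟩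
    toℕ x                                ≈⟨ res-+ x y ⟨
    res N x y + toℕ y                    ≈⟨ +-congˡₘ (res N x y) (res-+ y z) ⟨
    res N x y + (res N y z + toℕ z)      ≡⟨ +-assoc (res N x y) (res N y z) (toℕ z) ⟨
    res N x y + res N y z + toℕ z        ∎)
    where open ≡ₘ-Reasoning

  res-swap : ∀ x y → res N y x ≡ₘ N ∸ res N x y
  res-swap x y = +-cancelʳₘ (res N x y) (begin
    res N y x + res N x y                ≈⟨ res-trans y x y ⟨
    res N y y                            ≡⟨ res-self y ⟩
    0                                    ≈⟨ N≡ₘ0 ⟨
    N                                    ≡⟨ m∸n+n≡m (res≤N x y) ⟨
    N ∸ res N x y + res N x y            ∎)
    where open ≡ₘ-Reasoning

  dist-sym : ∀ x y → dist N x y ≡ dist N y x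
  dist-sym x y = sym (begin
    fold (res N y x)          ≡⟨ fold-≡ₘ (res≤N y x) (m∸n≤m N (res N x y)) (res-swap x y) ⟩
    fold (N ∸ res N x y)      ≡⟨ fold[N∸r]≡fold[r] (res≤N x y) ⟩
    fold (res N x y)          ∎)
    where open ≡.≡-Reasoning

  dist-self : ∀ x → dist N x x ≡ 0
  dist-self x = cong fold (res-self x)

  dist≡0⇒≡ : ∀ x y → dist N x y ≡ 0 → x ≡ y
  dist≡0⇒≡ x y d≡0 = toℕ-≡ₘ-injective (begin
    toℕ x               ≈⟨ res-+ x y ⟨
    res N x y + toℕ y   ≈⟨ +-congʳₘ (toℕ y) r≡0 ⟩
    toℕ y               ∎)
    where
    open ≡ₘ-Reasoning
    r≡0 : res N x y ≡ₘ 0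
    r≡0 with fold-injective (res≤N x y) z≤n d≡0
    ... | inj₁ r≡0 = r≡0
    ... | inj₂ r+0≡0 = trans (cong (_% N) (sym (+-identityʳ _))) r+0≡0

  dist≤ : ∀ {D} → N ≤ suc (D + D) → ∀ x y → dist N x y ≤ D
  dist≤ N≤1+2D x y = fold≤ N≤1+2D (res N x y)

  res≡1⇒res≡N∸1 : ∀ x y → res N x y ≡ 1 → res N y x ≡ N ∸ 1
  res≡1⇒res≡N∸1 x y r≡1 =
    ≡ₘ⇒≡ (res<N y x) (∸-monoʳ-< z<s (<⇒≤ 1<N)) (subst (λ r → res N y x ≡ₘ N ∸ r) r≡1 (res-swap x y))

  res≡N∸1⇒res≡1 : ∀ x y → res N x y ≡ N ∸ 1 → res N y x ≡ 1
  res≡N∸1⇒res≡1 x y r≡N∸1 =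
    ≡ₘ⇒≡ (res<N y x) 1<N
      (subst (res N y x ≡ₘ_) N∸[N∸1]≡1 (subst (λ r → res N y x ≡ₘ N ∸ r) r≡N∸1 (res-swap x y)))
    where
    N∸[N∸1]≡1 : N ∸ (N ∸ 1) ≡ 1
    N∸[N∸1]≡1 = m∸[m∸n]≡n (<⇒≤ 1<N)

  Adj-sym : ∀ x y → Adj N x y → Adj N y x
  Adj-sym x y = Sum.swap ∘ Sum.map (res≡1⇒res≡N∸1 x y) (res≡N∸1⇒res≡1 x y)

  res-predV : ∀ x → res N x (predV N x) ≡ 1
  res-predV x = res-unique x (predV N x) 1<N (begin
    1 + toℕ (predV N x)         ≈⟨ +-congˡₘ 1 (toℕ-vert _) ⟩
    1 + (toℕ x + (N ∸ 1))       ≡⟨ x∙yz≈y∙xz 1 (toℕ x) (N ∸ 1) ⟩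
    toℕ x + (1 + (N ∸ 1))       ≡⟨ cong (toℕ x +_) (m+[n∸m]≡n 0<N) ⟩
    toℕ x + N                   ≈⟨ +N≡ₘ (toℕ x) ⟩
    toℕ x                       ∎)
    where open ≡ₘ-Reasoning

  res-sucV : ∀ x → res N (sucV N x) x ≡ 1
  res-sucV x = res-unique (sucV N x) x 1<N (trans (cong (_% N) (+-comm 1 (toℕ x))) (sym (toℕ-vert _)))

  res≡ₘ1+res⇒dist≤1+dist : ∀ u w u' w' → res N u w ≡ₘ suc (res N u' w') →
                           dist N u w ≤ suc (dist N u' w')
  res≡ₘ1+res⇒dist≤1+dist u w u' w' eq =
    ≤-trans (≤-reflexive (fold-≡ₘ (res≤N u w) (res<N u' w') eq)) (fold[1+r]≤1+fold[r] (res N u' w'))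

  dist-adj : ∀ x x' z → Adj N x x' → dist N x z ≤ suc (dist N x' z)
  dist-adj x x' z (inj₁ r≡1) = res≡ₘ1+res⇒dist≤1+dist x z x' z (begin
    res N x z                  ≈⟨ res-trans x x' z ⟩
    res N x x' + res N x' z    ≡⟨ cong (_+ res N x' z) r≡1 ⟩
    suc (res N x' z)           ∎)
    where open ≡ₘ-Reasoning
  dist-adj x x' z (inj₂ r≡N∸1) =
    subst₂ (λ d d' → d ≤ suc d') (dist-sym z x) (dist-sym z x') (res≡ₘ1+res⇒dist≤1+dist z x z x' step)
    where
    step : res N z x ≡ₘ suc (res N z x')
    step = begin
      res N z x                 ≈⟨ res-trans z x' x ⟩
      res N z x' + res N x' x   ≡⟨ cong (res N z x' +_) (res≡N∸1⇒res≡1 x x' r≡N∸1) ⟩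
      res N z x' + 1            ≡⟨ +-comm (res N z x') 1 ⟩
      suc (res N z x')          ∎
      where open ≡ₘ-Reasoning

  dist-step : ∀ x y {n} → dist N x y ≡ suc n → Σ (Fin N) λ x' → Adj N x x' × dist N x' y ≡ n
  dist-step x y {n} d≡1+n with fold-cases (res N x y)
  ... | inj₁ fr≡r = predV N x , inj₁ (res-predV x) ,
    trans (fold-≡ₘ (res≤N _ y) (<⇒≤ n<N) r'≡n) (fold[1+n]≡1+n⇒fold[n]≡n (subst (λ r → fold r ≡ r) r≡1+n fr≡r))
    where
    r≡1+n : res N x y ≡ suc n
    r≡1+n = trans (sym fr≡r) d≡1+n
    n<N : n < N
    n<N = <-trans (n<1+n n) (subst (_< N) r≡1+n (res<N x y))
    r'≡n : res N (predV N x) y ≡ₘ n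
    r'≡n = +-cancelˡₘ 1 (begin
      1 + res N (predV N x) y                    ≡⟨ cong (_+ res N (predV N x) y) (res-predV x) ⟨
      res N x (predV N x) + res N (predV N x) y  ≈⟨ res-trans x (predV N x) y ⟨
      res N x y                                  ≡⟨ r≡1+n ⟩
      suc n                                      ∎)
      where open ≡ₘ-Reasoning
  ... | inj₂ fr≡N∸r = sucV N x , Adj-sym (sucV N x) x (inj₁ (res-sucV x)) ,
    trans (fold-≡ₘ (res≤N _ y) (res<N x y) r'≡1+r) (fold[r]≡N∸r⇒fold[1+r]≡fold[r]∸1 fr≡N∸r d≡1+n)
    where
    r'≡1+r : res N (sucV N x) y ≡ₘ suc (res N x y)
    r'≡1+r = begin
      res N (sucV N x) y                  ≈⟨ res-trans (sucV N x) x y ⟩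
      res N (sucV N x) x + res N x y      ≡⟨ cong (_+ res N x y) (res-sucV x) ⟩
      suc (res N x y)                     ∎
      where open ≡ₘ-Reasoning

  dist-nonexpanding : (h : Fin N → Fin N) → (∀ u v → Adj N u v → Adj N (h u) (h v)) →
                      ∀ n x y → dist N x y ≡ n → dist N (h x) (h y) ≤ n
  dist-nonexpanding h h-adj zero x y d≡0 with dist≡0⇒≡ x y d≡0
  ... | refl = ≤-reflexive (dist-self (h x))
  dist-nonexpanding h h-adj (suc n) x y d≡1+n with dist-step x y d≡1+n
  ... | x' , x~x' , d'≡n =
    ≤-trans (dist-adj (h x) (h x') (h y) (h-adj x x' x~x')) (s≤s (dist-nonexpanding h h-adj n x' y d'≡n))

  dist-Aut : (g : Aut N) → ∀ x y → dist N (Aut.perm g ⟨$⟩ʳ x) (Aut.perm g ⟨$⟩ʳ y) ≡ dist N x y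
  dist-Aut g x y = ≤-antisym (dist-nonexpanding σ σ-adj _ x y refl)
    (subst₂ (λ u v → dist N u v ≤ dist N (σ x) (σ y)) (inverseˡ π) (inverseˡ π)
      (dist-nonexpanding σ⁻¹ σ⁻¹-adj _ (σ x) (σ y) refl))
    where
    π : Permutation′ N
    π = Aut.perm g
    σ σ⁻¹ : Fin N → Fin N
    σ = π ⟨$⟩ʳ_
    σ⁻¹ = π ⟨$⟩ˡ_
    σ-adj : ∀ u v → Adj N u v → Adj N (σ u) (σ v)
    σ-adj u v = Equivalence.to (Aut.preserves g u v)
    σ⁻¹-adj : ∀ u v → Adj N u v → Adj N (σ⁻¹ u) (σ⁻¹ v)
    σ⁻¹-adj u v u~v = Equivalence.from (Aut.preserves g (σ⁻¹ u) (σ⁻¹ v))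
      (subst₂ (Adj N) (sym (inverseʳ π)) (sym (inverseʳ π)) u~v)

  dist≡⇒res≡± : ∀ u v u' v' → dist N u v ≡ dist N u' v' → res N v u ≡± res N v' u'
  dist≡⇒res≡± u v u' v' eq = fold-injective (res≤N v u) (res≤N v' u')
    (trans (sym (dist-sym u v)) (trans eq (dist-sym u' v')))

module Orbits (N : ℕ) {{_ : NonZero N}} (1<N : 1 < N) where
  open import Data.Nat using (_+_)
  open import Data.Nat.Properties
  open import Algebra.Properties.CommutativeSemigroup +-commutativeSemigroup
    using (interchange; x∙yz≈y∙xz; x∙yz≈y∙zx)
  open ≡ using (refl; sym; trans; cong; cong₂; subst)
  open Modular N
  open Cycle N 1<N

  sameOrbit⇒sameDistances : ∀ {x y z x' y' z'} → SameOrbit N (x , y , z) (x' , y' , z') →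
    dist N y z ≡ dist N y' z' × dist N x z ≡ dist N x' z' × dist N x y ≡ dist N x' y'
  sameOrbit⇒sameDistances {x} {y} {z} (g , refl , refl , refl) =
    sym (dist-Aut g y z) , sym (dist-Aut g x z) , sym (dist-Aut g x y)

  shift : ℕ → Fin N → Fin N
  shift s t = vert N (s + toℕ t)

  mirror : ℕ → Fin N → Fin N
  mirror c t = vert N (c + (N ∸ toℕ t))

  shift-inverse : ∀ {s s'} → s + s' ≡ₘ 0 → ∀ t → shift s (shift s' t) ≡ t
  shift-inverse {s} {s'} s+s'≡0 t = toℕ-≡ₘ-injective (begin
    toℕ (shift s (shift s' t))    ≈⟨ toℕ-vert _ ⟩
    s + toℕ (shift s' t)          ≈⟨ +-congˡₘ s (toℕ-vert _) ⟩
    s + (s' + toℕ t)              ≡⟨ +-assoc s s' (toℕ t) ⟨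
    s + s' + toℕ t                ≈⟨ +-congʳₘ (toℕ t) s+s'≡0 ⟩
    toℕ t                         ∎)
    where open ≡ₘ-Reasoning

  toℕ-mirror : ∀ c t → toℕ (mirror c t) + toℕ t ≡ₘ c
  toℕ-mirror c t = begin
    toℕ (mirror c t) + toℕ t      ≈⟨ +-congʳₘ (toℕ t) (toℕ-vert _) ⟩
    c + (N ∸ toℕ t) + toℕ t       ≡⟨ +-assoc c (N ∸ toℕ t) (toℕ t) ⟩
    c + (N ∸ toℕ t + toℕ t)       ≡⟨ cong (c +_) (m∸n+n≡m (<⇒≤ (toℕ<n t))) ⟩
    c + N                         ≈⟨ +N≡ₘ c ⟩
    c                             ∎
    where open ≡ₘ-Reasoning

  mirror-involutive : ∀ c t → mirror c (mirror c t) ≡ t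
  mirror-involutive c t = toℕ-≡ₘ-injective (+-cancelʳₘ (toℕ (mirror c t))
    (trans (toℕ-mirror c (mirror c t)) (trans (sym (toℕ-mirror c t)) (cong (_% N) (+-comm _ (toℕ t))))))

  res-shift : ∀ s x y → res N (shift s x) (shift s y) ≡ res N x y
  res-shift s x y = res-unique (shift s x) (shift s y) (res<N x y) (begin
    res N x y + toℕ (shift s y)   ≈⟨ +-congˡₘ (res N x y) (toℕ-vert _) ⟩
    res N x y + (s + toℕ y)       ≡⟨ x∙yz≈y∙xz (res N x y) s (toℕ y) ⟩
    s + (res N x y + toℕ y)       ≈⟨ +-congˡₘ s (res-+ x y) ⟩
    s + toℕ x                     ≈⟨ toℕ-vert _ ⟨
    toℕ (shift s x)               ∎)
    where open ≡ₘ-Reasoning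

  res-mirror : ∀ c x y → res N (mirror c x) (mirror c y) ≡ res N y x
  res-mirror c x y = res-unique (mirror c x) (mirror c y) (res<N y x) (+-cancelʳₘ (toℕ x + toℕ y) (begin
    res N y x + toℕ (mirror c y) + (toℕ x + toℕ y)       ≡⟨ interchange (res N y x) _ (toℕ x) (toℕ y) ⟩
    (res N y x + toℕ x) + (toℕ (mirror c y) + toℕ y)     ≈⟨ +-congₘ (res-+ y x) (toℕ-mirror c y) ⟩
    toℕ y + c                                            ≈⟨ +-congˡₘ (toℕ y) (toℕ-mirror c x) ⟨
    toℕ y + (toℕ (mirror c x) + toℕ x)                   ≡⟨ x∙yz≈y∙zx (toℕ y) (toℕ (mirror c x)) (toℕ x) ⟩
    toℕ (mirror c x) + (toℕ x + toℕ y)                   ∎))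
    where open ≡ₘ-Reasoning

  -- Adj N x y unfolds to IsStep (res N x y).
  IsStep : ℕ → Set
  IsStep r = r ≡ 1 ⊎ r ≡ N ∸ 1

  res-preserving⇒Adj⇔ : ∀ {f : Fin N → Fin N} → (∀ x y → res N (f x) (f y) ≡ res N x y) →
                        ∀ x y → Adj N x y ⇔ Adj N (f x) (f y)
  res-preserving⇒Adj⇔ res-f x y = mk⇔ (subst IsStep (sym (res-f x y))) (subst IsStep (res-f x y))

  res-reversing⇒Adj⇔ : ∀ {f : Fin N → Fin N} → (∀ x y → res N (f x) (f y) ≡ res N y x) →
                       ∀ x y → Adj N x y ⇔ Adj N (f x) (f y)
  res-reversing⇒Adj⇔ res-f x y = mk⇔
    (subst IsStep (sym (res-f x y)) ∘ Adj-sym x y) (Adj-sym y x ∘ subst IsStep (res-f x y))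

  rotation : ℕ → Aut N
  rotation s = record
    { perm      = permutation (shift s) (shift s⁻) (shift-inverse s+s⁻≡0) (shift-inverse s⁻+s≡0)
    ; preserves = res-preserving⇒Adj⇔ {shift s} (res-shift s)
    }
    where
    s⁻ : ℕ
    s⁻ = N ∸ s % N
    s+s⁻≡0 : s + s⁻ ≡ₘ 0
    s+s⁻≡0 = +-inverseʳₘ s
    s⁻+s≡0 : s⁻ + s ≡ₘ 0
    s⁻+s≡0 = trans (cong (_% N) (+-comm s⁻ s)) s+s⁻≡0

  reflection : ℕ → Aut N
  reflection c = record
    { perm      = permutation (mirror c) (mirror c) (mirror-involutive c) (mirror-involutive c)
    ; preserves = res-reversing⇒Adj⇔ {mirror c} (res-mirror c)
    }

  shift-maps : ∀ x x' {u u'} → res N u x ≡ₘ res N u' x' → shift (res N x' x) u ≡ u'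
  shift-maps x x' {u} {u'} eq = toℕ-≡ₘ-injective (begin
    toℕ (shift (res N x' x) u)           ≈⟨ toℕ-vert _ ⟩
    res N x' x + toℕ u                   ≈⟨ +-congˡₘ (res N x' x) (res-+ u x) ⟨
    res N x' x + (res N u x + toℕ x)     ≡⟨ x∙yz≈y∙xz (res N x' x) (res N u x) (toℕ x) ⟩
    res N u x + (res N x' x + toℕ x)     ≈⟨ +-congₘ eq (res-+ x' x) ⟩
    res N u' x' + toℕ x'                 ≈⟨ res-+ u' x' ⟩
    toℕ u'                               ∎)
    where open ≡ₘ-Reasoning

  mirror-maps : ∀ x x' {u u'} → res N u x + res N u' x' ≡ₘ 0 → mirror (toℕ x + toℕ x') u ≡ u'
  mirror-maps x x' {u} {u'} eq = toℕ-≡ₘ-injective (+-cancelʳₘ (toℕ u) (begin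
    toℕ (mirror (toℕ x + toℕ x') u) + toℕ u               ≈⟨ toℕ-mirror _ u ⟩
    toℕ x + toℕ x'                                        ≈⟨ +-congʳₘ (toℕ x + toℕ x') eq ⟨
    (res N u x + res N u' x') + (toℕ x + toℕ x')          ≡⟨ interchange (res N u x) _ (toℕ x) (toℕ x') ⟩
    (res N u x + toℕ x) + (res N u' x' + toℕ x')          ≈⟨ +-congₘ (res-+ u x) (res-+ u' x') ⟩
    toℕ u + toℕ u'                                        ≡⟨ +-comm (toℕ u) (toℕ u') ⟩
    toℕ u' + toℕ u                                        ∎))
    where open ≡ₘ-Reasoning

  sameDistances⇒sameOrbit : ∀ {x y z x' y' z'} →
    dist N y z ≡ dist N y' z' → dist N x z ≡ dist N x' z' → dist N x y ≡ dist N x' y' →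
    SameOrbit N (x , y , z) (x' , y' , z')
  sameDistances⇒sameOrbit {x} {y} {z} {x'} {y'} {z'} d-yz d-xz d-xy
    with signs-agree (res-trans z y x) (res-trans z' y' x')
                     (dist≡⇒res≡± y z y' z' d-yz) (dist≡⇒res≡± x y x' y' d-xy) (dist≡⇒res≡± x z x' z' d-xz)
  ... | inj₁ (y↦y' , z↦z') =
    rotation (res N x' x) , shift-maps x x' x↦x' , shift-maps x x' y↦y' , shift-maps x x' z↦z'
    where
    x↦x' : res N x x ≡ₘ res N x' x'
    x↦x' = cong (_% N) (trans (res-self x) (sym (res-self x')))
  ... | inj₂ (y↦y' , z↦z') =
    reflection (toℕ x + toℕ x') , mirror-maps x x' x↦x' , mirror-maps x x' y↦y' , mirror-maps x x' z↦z'
    where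
    x↦x' : res N x x + res N x' x' ≡ₘ 0
    x↦x' = cong (_% N) (cong₂ _+_ (res-self x) (res-self x'))

module Field {c ℓ} (F : CommutativeRing c ℓ) (isField : IsField F) where
  open CommutativeRing F
  open import Relation.Binary.Reasoning.Setoid setoid

  x≉0∧y≉0⇒x*y≉0 : ∀ {x y} → ¬ x ≈ 0# → ¬ y ≈ 0# → ¬ x * y ≈ 0#
  x≉0∧y≉0⇒x*y≉0 {x} {y} x≉0 y≉0 xy≈0 with IsField.inv isField x x≉0
  ... | x⁻¹ , xx⁻¹≈1 = y≉0 (begin
    y                ≈⟨ *-identityˡ y ⟨
    1# * y           ≈⟨ *-congʳ (trans (*-comm x⁻¹ x) xx⁻¹≈1) ⟨
    (x⁻¹ * x) * y    ≈⟨ *-assoc x⁻¹ x y ⟩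
    x⁻¹ * (x * y)    ≈⟨ *-congˡ xy≈0 ⟩
    x⁻¹ * 0#         ≈⟨ zeroʳ x⁻¹ ⟩
    0#               ∎)

module PrimitiveRoot {c ℓ} (F : CommutativeRing c ℓ) (isField : IsField F) (N : ℕ) {{_ : NonZero N}}
                     (ζ : CommutativeRing.Carrier F) (ζ-primitive : IsPrimitiveRoot F N ζ) where
  open CommutativeRing F
  open import Algebra.Definitions.RawSemiring (Semiring.rawSemiring semiring) using (_^_)
  open import Algebra.Properties.Semiring.Exp semiring using (^-homo-*)
  open import Algebra.Properties.Ring ring using (x∙y⁻¹≈ε⇒x≈y; //-rightDividesˡ; +-identityˡ-unique)
  open import Relation.Binary.Reasoning.Setoid setoid
  open Field F isField
  import Algebra.Solver.Ring.NaturalCoefficients.Default commutativeSemiring as Solver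

  θ : ℕ → Carrier
  θ = θ* F N ζ

  ζ^-+ : ∀ i j {k} → i ℕ.+ j ≡ k → ζ ^ i * ζ ^ j ≈ ζ ^ k
  ζ^-+ i j i+j≡k = trans (sym (^-homo-* ζ i j)) (reflexive (≡.cong (ζ ^_) i+j≡k))

  ζ^≉0 : ∀ {m} → m ≤ N → ¬ ζ ^ m ≈ 0#
  ζ^≉0 {m} m≤N ζ^m≈0 = IsField.1≉0 isField (begin
    1#                     ≈⟨ proj₁ ζ-primitive ⟨
    ζ ^ N                  ≈⟨ ζ^-+ m (N ∸ m) (ℕₚ.m+[n∸m]≡n m≤N) ⟨
    ζ ^ m * ζ ^ (N ∸ m)    ≈⟨ *-congʳ ζ^m≈0 ⟩
    0# * ζ ^ (N ∸ m)       ≈⟨ zeroˡ _ ⟩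
    0#                     ∎)

  1-ζ^≉0 : ∀ {j} → 0 < j → j < N → ¬ 1# - ζ ^ j ≈ 0#
  1-ζ^≉0 {j} 0<j j<N 1-ζ^j≈0 = proj₂ ζ-primitive j 0<j j<N (sym (x∙y⁻¹≈ε⇒x≈y 1# (ζ ^ j) 1-ζ^j≈0))

  1-x+x≈1 : ∀ x → 1# - x + x ≈ 1#
  1-x+x≈1 x = //-rightDividesˡ x 1#

  θ-gap : ∀ {m k} → m < k → k ℕ.+ m < N →
          θ m ≈ ζ ^ m * (1# - ζ ^ (k ∸ m)) * (1# - ζ ^ (N ∸ (k ℕ.+ m))) + θ k
  θ-gap {m} {k} m<k k+m<N = begin
    ζ ^ m + ζ ^ (N ∸ m)                             ≈⟨ +-cong (*-identityʳ _) PAB ⟨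
    P * 1# + P * A * B                              ≈⟨ +-congʳ (*-identityʳ (P * 1#)) ⟨
    P * 1# * 1# + P * A * B                         ≈⟨ +-congʳ (*-cong (*-congˡ (1-x+x≈1 A)) (1-x+x≈1 B)) ⟨
    -- The solver works over the underlying semiring, so u = 1 − A and w = 1 − B enter as atoms.
    P * (u + A) * (w + B) + P * A * B               ≈⟨ Solver.solve 5 (λ P u A w B →
                                                         P :* (u :+ A) :* (w :+ B) :+ P :* A :* B :=
                                                         P :* u :* w :+ (P :* A :* (w :+ B) :+ P :* (u :+ A) :* B))
                                                         refl P u A w B ⟩
    P * u * w + (P * A * (w + B) + P * (u + A) * B) ≈⟨ +-congˡ (+-cong (*-congˡ (1-x+x≈1 B))
                                                                       (*-congʳ (*-congˡ (1-x+x≈1 A)))) ⟩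
    P * u * w + (P * A * 1# + P * 1# * B)           ≈⟨ +-congˡ (+-cong (trans (*-identityʳ _) PA)
                                                                       (trans (*-congʳ (*-identityʳ P)) PB)) ⟩
    P * u * w + (ζ ^ k + ζ ^ (N ∸ k))               ∎
    where
    open Solver using (_:+_; _:*_; _:=_)
    P A B u w : Carrier
    P = ζ ^ m
    A = ζ ^ (k ∸ m)
    B = ζ ^ (N ∸ (k ℕ.+ m))
    u = 1# - A
    w = 1# - B
    k+m≤N : k ℕ.+ m ≤ N
    k+m≤N = ℕₚ.<⇒≤ k+m<N
    i+[N∸s]≡N∸j : ∀ i j {s} → j ℕ.+ i ≡ s → s ≤ N → i ℕ.+ (N ∸ s) ≡ N ∸ j
    i+[N∸s]≡N∸j i j ≡.refl j+i≤N = ≡.trans (≡.cong (i ℕ.+_) (≡.sym (ℕₚ.∸-+-assoc N j i)))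
      (ℕₚ.m+[n∸m]≡n (ℕₚ.m+n≤o⇒m≤o∸n i (ℕₚ.≤-trans (ℕₚ.≤-reflexive (ℕₚ.+-comm i j)) j+i≤N)))
    PA : P * A ≈ ζ ^ k
    PA = ζ^-+ m (k ∸ m) (ℕₚ.m+[n∸m]≡n (ℕₚ.<⇒≤ m<k))
    PB : P * B ≈ ζ ^ (N ∸ k)
    PB = ζ^-+ m (N ∸ (k ℕ.+ m)) (i+[N∸s]≡N∸j m k ≡.refl k+m≤N)
    PAB : P * A * B ≈ ζ ^ (N ∸ m)
    PAB = trans (*-congʳ PA) (ζ^-+ k (N ∸ (k ℕ.+ m)) (i+[N∸s]≡N∸j k m (ℕₚ.+-comm m k) k+m≤N))

  θ≉θ : ∀ {m k} → m < k → k ℕ.+ m < N → ¬ θ m ≈ θ k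
  θ≉θ {m} {k} m<k k+m<N θm≈θk =
    x≉0∧y≉0⇒x*y≉0 (x≉0∧y≉0⇒x*y≉0 (ζ^≉0 m≤N) (1-ζ^≉0 (ℕₚ.m<n⇒0<n∸m m<k) k∸m<N))
                  (1-ζ^≉0 (ℕₚ.m<n⇒0<n∸m k+m<N) N∸[k+m]<N)
                  (+-identityˡ-unique _ (θ k) (trans (sym (θ-gap m<k k+m<N)) θm≈θk))
    where
    m≤N : m ≤ N
    m≤N = ℕₚ.≤-trans (ℕₚ.m≤n+m m k) (ℕₚ.<⇒≤ k+m<N)
    k∸m<N : k ∸ m < N
    k∸m<N = ℕₚ.≤-<-trans (ℕₚ.m∸n≤m k m) (ℕₚ.≤-<-trans (ℕₚ.m≤m+n k m) k+m<N)
    N∸[k+m]<N : N ∸ (k ℕ.+ m) < N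
    N∸[k+m]<N = ℕₚ.∸-monoʳ-< (ℕₚ.<-≤-trans (ℕₚ.≤-<-trans z≤n m<k) (ℕₚ.m≤m+n k m)) (ℕₚ.<⇒≤ k+m<N)

  θ-injective : ∀ {D m k} → D ℕ.+ D ≤ N → m ≤ D → k ≤ D → θ m ≈ θ k → m ≡ k
  θ-injective {D} {m} {k} D+D≤N m≤D k≤D θm≈θk = by-trichotomy (ℕₚ.<-cmp m k)
    where
    bound : ∀ {i j} → i < j → j ≤ D → j ℕ.+ i < N
    bound {i} {j} i<j j≤D = ℕₚ.<-≤-trans (ℕₚ.+-monoʳ-< j i<j) (ℕₚ.≤-trans (ℕₚ.+-mono-≤ j≤D j≤D) D+D≤N)
    by-trichotomy : Tri (m < k) (m ≡ k) (k < m) → m ≡ k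
    by-trichotomy (tri< m<k _ _) = ⊥-elim (θ≉θ m<k (bound m<k k≤D) θm≈θk)
    by-trichotomy (tri≈ _ m≡k _) = m≡k
    by-trichotomy (tri> _ _ k<m) = ⊥-elim (θ≉θ k<m (bound k<m m≤D) (sym θm≈θk))

module Restriction {c ℓ} (F : CommutativeRing c ℓ) (N : ℕ) where
  open CommutativeRing F using (0#)
  open import Data.Nat using (_≟_)

  restrict : (Fin N → Fin N → Fin N → ℕ) → ℕ → Tensor3 F N → Tensor3 F N
  restrict f k v x y z with f x y z ≟ k
  ... | yes _ = v x y z
  ... | no _  = 0#

  restrict-≡ : ∀ {f k v x y z} → f x y z ≡ k → restrict f k v x y z ≡ v x y z
  restrict-≡ {f} {k} {v} {x} {y} {z} fxyz≡k with f x y z ≟ k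
  ... | yes _     = ≡.refl
  ... | no fxyz≢k = ⊥-elim (fxyz≢k fxyz≡k)

  restrict-≢ : ∀ {f k v x y z} → f x y z ≢ k → restrict f k v x y z ≡ 0#
  restrict-≢ {f} {k} {v} {x} {y} {z} fxyz≢k with f x y z ≟ k
  ... | yes fxyz≡k = ⊥-elim (fxyz≢k fxyz≡k)
  ... | no _       = ≡.refl

module Projection {c ℓ} (F : CommutativeRing c ℓ) (isField : IsField F) (N : ℕ) {{_ : NonZero N}}
                  (ζ : CommutativeRing.Carrier F) (ζ-primitive : IsPrimitiveRoot F N ζ)
                  (D : ℕ) (D+D≤N : D ℕ.+ D ≤ N) where
  open CommutativeRing F
  open import Data.Nat using (_≟_)
  open import Relation.Binary.Reasoning.Setoid setoid
  open import Algebra.Properties.Ring ring using (x∙y⁻¹≈ε⇒x≈y)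
  open Field F isField
  open PrimitiveRoot F isField N ζ ζ-primitive
  open Restriction F N

  lagrange : ℕ → ℕ → Carrier → Carrier
  lagrange k zero    t = 1#
  lagrange k (suc e) t with e ≟ k
  ... | yes _ = lagrange k e t
  ... | no _  = (t - θ e) * lagrange k e t

  lagrange-root : ∀ {k n e} → e < n → e ≢ k → lagrange k n (θ e) ≈ 0#
  lagrange-root {k} {suc n} {e} e<1+n e≢k with n ≟ k | e ≟ n
  ... | yes ≡.refl | _      = lagrange-root (ℕₚ.≤∧≢⇒< (s≤s⁻¹ e<1+n) e≢k) e≢k
  ... | no _     | yes ≡.refl = trans (*-congʳ (-‿inverseʳ (θ e))) (zeroˡ _)
  ... | no _     | no e≢n = trans (*-congˡ (lagrange-root (ℕₚ.≤∧≢⇒< (s≤s⁻¹ e<1+n) e≢n) e≢k)) (zeroʳ _)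

  lagrange-θ≉0 : ∀ {k n} → k ≤ D → n ≤ suc D → ¬ lagrange k n (θ k) ≈ 0#
  lagrange-θ≉0 {k} {zero}  k≤D n≤1+D = IsField.1≉0 isField
  lagrange-θ≉0 {k} {suc n} k≤D n<1+D with n ≟ k
  ... | yes _   = lagrange-θ≉0 k≤D (ℕₚ.≤-trans (ℕₚ.n≤1+n n) n<1+D)
  ... | no n≢k  = x≉0∧y≉0⇒x*y≉0 (n≢k ∘ ≡.sym ∘ θ-injective D+D≤N k≤D (s≤s⁻¹ n<1+D) ∘ x∙y⁻¹≈ε⇒x≈y _ _)
                                (lagrange-θ≉0 k≤D (ℕₚ.≤-trans (ℕₚ.n≤1+n n) n<1+D))

  module _ (f : Fin N → Fin N → Fin N → ℕ) (f≤D : ∀ x y z → f x y z ≤ D)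
           (Λ-closed : ∀ {v} → InΛ F N ζ v → InΛ F N ζ (λ x y z → θ (f x y z) * v x y z)) where

    InΛ-lagrange : ∀ k n {v} → InΛ F N ζ v → InΛ F N ζ (λ x y z → lagrange k n (θ (f x y z)) * v x y z)
    InΛ-lagrange k zero    v∈Λ = resp (λ x y z → sym (*-identityˡ _)) v∈Λ
    InΛ-lagrange k (suc e) {v} v∈Λ with e ≟ k
    ... | yes _ = InΛ-lagrange k e v∈Λ
    ... | no _  = resp (λ x y z → trans (sym (distribʳ _ (θ (f x y z)) (- θ e))) (sym (*-assoc _ _ _)))
                       (add (Λ-closed w∈Λ) (scale (- θ e) w∈Λ))
      where
      w∈Λ : InΛ F N ζ (λ x y z → lagrange k e (θ (f x y z)) * v x y z)
      w∈Λ = InΛ-lagrange k e v∈Λ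

    InΛ-restrict : ∀ {k v} → k ≤ D → InΛ F N ζ v → InΛ F N ζ (restrict f k v)
    InΛ-restrict {k} {v} k≤D v∈Λ
      with IsField.inv isField (lagrange k (suc D) (θ k)) (lagrange-θ≉0 k≤D ℕₚ.≤-refl)
    ... | c⁻¹ , cc⁻¹≈1 = resp normalise (scale c⁻¹ (InΛ-lagrange k (suc D) v∈Λ))
      where
      normalise : ∀ x y z → c⁻¹ * (lagrange k (suc D) (θ (f x y z)) * v x y z) ≈ restrict f k v x y z
      normalise x y z with f x y z ≟ k
      ... | yes ≡.refl = begin
        c⁻¹ * (lagrange k (suc D) (θ k) * v x y z)     ≈⟨ *-assoc _ _ _ ⟨
        (c⁻¹ * lagrange k (suc D) (θ k)) * v x y z     ≈⟨ *-congʳ (trans (*-comm _ _) cc⁻¹≈1) ⟩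
        1# * v x y z                                   ≈⟨ *-identityˡ _ ⟩
        v x y z                                        ∎
      ... | no fxyz≢k = begin
        c⁻¹ * (lagrange k (suc D) (θ (f x y z)) * v x y z)
          ≈⟨ *-congˡ (*-congʳ (lagrange-root (s≤s (f≤D x y z)) fxyz≢k)) ⟩
        c⁻¹ * (0# * v x y z)  ≈⟨ *-congˡ (zeroˡ _) ⟩
        c⁻¹ * 0#              ≈⟨ zeroʳ _ ⟩
        0#                    ∎

module OrbitIndicator {c ℓ} (F : CommutativeRing c ℓ) (N : ℕ) {{_ : NonZero N}} (1<N : 1 < N) where
  open CommutativeRing F using (_≈_; 0#; 1#; trans; reflexive)
  open import Data.Nat using (_≟_)
  open Orbits N 1<N
  open Restriction F N

  ∂⁽¹⁾ ∂⁽²⁾ ∂⁽³⁾ : Fin N → Fin N → Fin N → ℕ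
  ∂⁽¹⁾ _ y z = dist N y z
  ∂⁽²⁾ x _ z = dist N x z
  ∂⁽³⁾ x y _ = dist N x y

  IsOrbitIndicator : Fin N → Fin N → Fin N → Tensor3 F N → Set _
  IsOrbitIndicator x y z χ = ∀ x' y' z' →
    (SameOrbit N (x , y , z) (x' , y' , z') → χ x' y' z' ≈ 1#) ×
    (¬ SameOrbit N (x , y , z) (x' , y' , z') → χ x' y' z' ≈ 0#)

  restrict-to-orbit : Fin N → Fin N → Fin N → Tensor3 F N → Tensor3 F N
  restrict-to-orbit x y z v =
    restrict ∂⁽³⁾ (∂⁽³⁾ x y z) (restrict ∂⁽²⁾ (∂⁽²⁾ x y z) (restrict ∂⁽¹⁾ (∂⁽¹⁾ x y z) v))

  orbit-indicator≈restrict-to-orbit : ∀ {x y z χ} → IsOrbitIndicator x y z χ →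
    ∀ x' y' z' → χ x' y' z' ≈ restrict-to-orbit x y z (λ _ _ _ → 1#) x' y' z'
  orbit-indicator≈restrict-to-orbit {x} {y} {z} {χ} χ-indicator x' y' z' =
    by-cases (∂⁽¹⁾ x' y' z' ≟ ∂⁽¹⁾ x y z) (∂⁽²⁾ x' y' z' ≟ ∂⁽²⁾ x y z) (∂⁽³⁾ x' y' z' ≟ ∂⁽³⁾ x y z)
    where
    inΩ : Set
    inΩ = SameOrbit N (x , y , z) (x' , y' , z')
    χ≈1 : inΩ → χ x' y' z' ≈ 1#
    χ≈1 = proj₁ (χ-indicator x' y' z')
    χ≈0 : ¬ inΩ → χ x' y' z' ≈ 0#
    χ≈0 = proj₂ (χ-indicator x' y' z')
    by-cases : Dec (∂⁽¹⁾ x' y' z' ≡ ∂⁽¹⁾ x y z) → Dec (∂⁽²⁾ x' y' z' ≡ ∂⁽²⁾ x y z) →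
               Dec (∂⁽³⁾ x' y' z' ≡ ∂⁽³⁾ x y z) → χ x' y' z' ≈ restrict-to-orbit x y z (λ _ _ _ → 1#) x' y' z'
    by-cases (yes e₁) (yes e₂) (yes e₃) =
      trans (χ≈1 (sameDistances⇒sameOrbit (≡.sym e₁) (≡.sym e₂) (≡.sym e₃)))
            (reflexive (≡.sym (≡.trans (restrict-≡ {∂⁽³⁾} e₃)
                                       (≡.trans (restrict-≡ {∂⁽²⁾} e₂) (restrict-≡ {∂⁽¹⁾} e₁)))))
    by-cases _ _ (no e₃̸) =
      trans (χ≈0 (e₃̸ ∘ ≡.sym ∘ proj₂ ∘ proj₂ ∘ sameOrbit⇒sameDistances))
            (reflexive (≡.sym (restrict-≢ {∂⁽³⁾} e₃̸)))
    by-cases _ (no e₂̸) (yes e₃) =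
      trans (χ≈0 (e₂̸ ∘ ≡.sym ∘ proj₁ ∘ proj₂ ∘ sameOrbit⇒sameDistances))
            (reflexive (≡.sym (≡.trans (restrict-≡ {∂⁽³⁾} e₃) (restrict-≢ {∂⁽²⁾} e₂̸))))
    by-cases (no e₁̸) (yes e₂) (yes e₃) =
      trans (χ≈0 (e₁̸ ∘ ≡.sym ∘ proj₁ ∘ sameOrbit⇒sameDistances))
            (reflexive (≡.sym (≡.trans (restrict-≡ {∂⁽³⁾} e₃)
                                       (≡.trans (restrict-≡ {∂⁽²⁾} e₂) (restrict-≢ {∂⁽¹⁾} e₁̸)))))

open import Data.Nat using (ℕ; _+_; _*_; _≤_; NonZero)
open import Data.Fin using (Fin)
open import Data.Product using (_×_; _,_)
open import Data.Sum using (_⊎_)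
open import Relation.Nullary using (¬_)
open import Relation.Binary.PropositionalEquality using (_≡_)

diameter-bounds : ∀ {N} D → N ≡ 2 * D ⊎ N ≡ 2 * D + 1 → D + D ≤ N × N ≤ suc (D + D)
diameter-bounds D (inj₁ ≡.refl) = ℕₚ.≤-reflexive (≡.sym 2D≡D+D) , ℕₚ.≤-trans (ℕₚ.≤-reflexive 2D≡D+D) (ℕₚ.n≤1+n (D + D))
  where
  2D≡D+D : 2 * D ≡ D + D
  2D≡D+D = ≡.cong (D +_) (ℕₚ.+-identityʳ D)
diameter-bounds D (inj₂ ≡.refl) = ℕₚ.≤-trans (ℕₚ.n≤1+n (D + D)) (ℕₚ.≤-reflexive (≡.sym 2D+1≡1+D+D)) ,
                                  ℕₚ.≤-reflexive 2D+1≡1+D+D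
  where
  2D+1≡1+D+D : 2 * D + 1 ≡ suc (D + D)
  2D+1≡1+D+D = ≡.trans (ℕₚ.+-comm (2 * D) 1) (≡.cong (λ t → suc (D + t)) (ℕₚ.+-identityʳ D))

lemma6p3 : ∀ {c ℓ} (F : CommutativeRing c ℓ) → IsField F → CharZero F →
    ∀ (D : ℕ) → 2 ≤ D → ∀ (N : ℕ) {{_ : NonZero N}} → (N ≡ 2 * D ⊎ N ≡ 2 * D + 1) →
    ∀ (ζ : CommutativeRing.Carrier F) → IsPrimitiveRoot F N ζ →
    ∀ (x y z : Fin N) (χ : Tensor3 F N) →
    (∀ x' y' z' →
      (SameOrbit N (x , y , z) (x' , y' , z') →
        CommutativeRing._≈_ F (χ x' y' z') (CommutativeRing.1# F))
      × (¬ SameOrbit N (x , y , z) (x' , y' , z') →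
        CommutativeRing._≈_ F (χ x' y' z') (CommutativeRing.0# F))) →
    InΛ F N ζ χ
lemma6p3 F isField _ D 2≤D N N≡2D⊎2D+1 ζ ζ-primitive x y z χ χ-indicator =
  resp (λ x' y' z' → sym (orbit-indicator≈restrict-to-orbit χ-indicator x' y' z'))
       (InΛ-restrict ∂⁽³⁾ (λ u v _ → dist≤ N≤1+D+D u v) a*3 (dist≤ N≤1+D+D x y)
         (InΛ-restrict ∂⁽²⁾ (λ u _ w → dist≤ N≤1+D+D u w) a*2 (dist≤ N≤1+D+D x z)
           (InΛ-restrict ∂⁽¹⁾ (λ _ v w → dist≤ N≤1+D+D v w) a*1 (dist≤ N≤1+D+D y z) gen)))
  where
  open CommutativeRing F using (sym)
  D+D≤N : D + D ≤ N
  D+D≤N = proj₁ (diameter-bounds D N≡2D⊎2D+1)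
  N≤1+D+D : N ≤ suc (D + D)
  N≤1+D+D = proj₂ (diameter-bounds D N≡2D⊎2D+1)
  1<N : 1 < N
  1<N = ℕₚ.≤-trans 2≤D (ℕₚ.≤-trans (ℕₚ.m≤m+n D D) D+D≤N)
  open Cycle N 1<N using (dist≤)
  open OrbitIndicator F N 1<N
  open Projection F isField N ζ ζ-primitive D D+D≤N
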